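{- Let $n,m$ be positive integers, $X=(x_1,\dots,x_n)$, and let $G_{n,m}=S_n\wr\mathbb{Z}_m$ act on $\mathbb{C}[X]$ by the quasi-symmetrizing action $\bullet$ described in the context. For $P\in\mathbb{C}[X]$, we have $g\bullet P=P$ for all $g\in G_{n,m}$ if and only if there exists a quasi-symmetric polynomial $Q\in QSym_n$ such that $P(X)=Q(x_1^m,\dots,x_n^m)$.
   Context: $G_{n,m}=S_n\wr\mathbb{Z}_m$ is realized as the group of $n\times n$ matrices having exactly one nonzero entry in each row and each column, these nonzero entries being complex $m$-th roots of unity. For $g\in G_{n,m}$, let $w(g)$ be the product of its nonzero entries, and let $\sigma_g$ be the permutation of $\{1,\dots,n\}$ defined by $g_{j,\sigma_g(j)}\neq 0$. Every monomial can be written uniquely as $x_{a_1}^{k_1}\cdots x_{a_l}^{k_l}$ with $l\ge 0$, $a_1<\dots<a_l$ and all $k_i\ge 1$; set $K=(k_1,\dots,k_l)$ and $c(K)=0$ if every $k_i$ is divisible by $m$ (in particular if $l=0$), and $c(K)=1$ otherwise. The action is defined on monomials by $g\bullet (x_{a_1}^{k_1}\cdots x_{a_l}^{k_l})=w(g)^{c(K)}\,x_{b_1}^{k_1}\cdots x_{b_l}^{k_l}$, where $b_1<\dots<b_l$ is the increasing rearrangement of $\sigma_g(a_1),\dots,\sigma_g(a_l)$, and extended linearly to $\mathbb{C}[X]$. A polynomial $Q\in\mathbb{C}[X]$ is quasi-symmetric if for all $\nu,\mu\in\mathbb{N}^n$, the coefficients of $x^\nu$ and $x^\mu$ in $Q$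 are equal whenever the sequences obtained from $\nu$ and $\mu$ by deleting their zero entries coincide; $QSym_n$ denotes the space of such polynomials. -}

module Defs where

open import Level using (Level)
open import Algebra.Bundles using (CommutativeRing)
open import Data.Nat as ℕ using (ℕ; zero; suc)
open import Data.Nat.Divisibility using (_∣_; _∣?_)
open import Data.Fin using (Fin; toℕ)
open import Data.Fin.Permutation using (Permutation; _⟨$⟩ʳ_; _⟨$⟩ˡ_)
open import Data.Bool using (Bool; true; false; if_then_else_)
open import Data.List using (List; []; _∷_; map; filterᵇ)
open import Data.Nat.ListAction using (sum)
open import Data.Bool using (_∧_)
open import Data.Vec as V using (Vec; lookup; tabulate; toList)
open import Data.Vec.Properties using (≡-dec)
open import Data.Product using (_×_; _,_; Σ)
open import Relation.Binary.PropositionalEquality using (_≡_)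
open import Relation.Nullary.Decidable using (⌊_⌋)
open import Relation.Nullary using (¬_)

-- Composition of an exponent vector: the sequence obtained by deleting zero entries.
nz : ℕ → Bool
nz zero = false
nz (suc _) = true

compress : ∀ {n} → Vec ℕ n → List ℕ
compress ν = filterᵇ nz (toList ν)

cK : ℕ → List ℕ → ℕ
cK m K = if allDiv K then 0 else 1
  where
  allDiv : List ℕ → Bool
  allDiv [] = true
  allDiv (k ∷ K) = ⌊ m ∣? k ⌋ ∧ allDiv K

fill : ∀ {n} → Vec Bool n → List ℕ → Vec ℕ n
fill V.[]          K        = V.[]
fill (false V.∷ S) K        = 0 V.∷ fill S K
fill (true  V.∷ S) []       = 0 V.∷ fill S []
fill (true  V.∷ S) (k ∷ K)  = k V.∷ fill S K

-- An element of G_{n,m} = S_n ≀ Z_m: the matrix with entry ζ^(e j) at (j, σ j)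
-- and zeros elsewhere, where ζ is a fixed primitive m-th root of unity.
record Elt (n m : ℕ) : Set where
  constructor elt
  field
    σ : Permutation n n
    e : Fin n → Fin m

-- Exponent vector of σ • x^ν (ignoring the scalar): the composition of ν is
-- placed on the increasingly ordered set σ(supp ν).
relocate : ∀ {n} → Permutation n n → Vec ℕ n → Vec ℕ n
relocate {n} σ ν = fill (tabulate (λ j → nz (lookup ν (σ ⟨$⟩ˡ j)))) (compress ν)

module Over {c ℓ : Level} (R : CommutativeRing c ℓ) where
  open CommutativeRing R

  pow : Carrier → ℕ → Carrier
  pow x zero = 1#
  pow x (suc k) = x * pow x k

  NoZeroDivisors : Set _
  NoZeroDivisors = ∀ x y → x * y ≈ 0# → (x ≈ 0#) Data.Sum.⊎ (y ≈ 0#)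
    where import Data.Sum

  IsPrimitiveRoot : ℕ → Carrier → Set _
  IsPrimitiveRoot m ζ = pow ζ m ≈ 1# × (∀ k → 0 ℕ.< k → k ℕ.< m → ¬ (pow ζ k ≈ 1#))

  Poly : ℕ → Set c
  Poly n = List (Carrier × Vec ℕ n)

  coeff : ∀ {n} → Poly n → Vec ℕ n → Carrier
  coeff [] μ = 0#
  coeff ((a , ν) ∷ P) μ = (if ⌊ ≡-dec ℕ._≟_ ν μ ⌋ then a else 0#) + coeff P μ

  _≈ₚ_ : ∀ {n} → Poly n → Poly n → Set ℓ
  P ≈ₚ Q = ∀ μ → coeff P μ ≈ coeff Q μ

  -- w(g) = product of the nonzero entries = ζ^(Σ_j e j).
  w : ∀ {n m} → Carrier → Elt n m → Carrier
  w {n} ζ g = pow ζ (sum (toList (tabulate (λ j → toℕ (Elt.e g j)))))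

  act : ∀ {n m} → Carrier → Elt n m → Poly n → Poly n
  act {m = m} ζ g = map (λ { (a , ν) → (pow (w ζ g) (cK m (compress ν)) * a , relocate (Elt.σ g) ν) })

  IsQSym : ∀ {n} → Poly n → Set _
  IsQSym Q = ∀ ν μ → compress ν ≡ compress μ → coeff Q ν ≈ coeff Q μ

  substPow : ∀ {n} → ℕ → Poly n → Poly n
  substPow m = map (λ { (a , ν) → (a , V.map (m ℕ.*_) ν) })

-- By the coefficient formula for the action (coeff-act), the μ-coefficient of g • P is
-- w(g)^c(μ) times the coefficient of P at the relocated exponent σ_g⁻¹ · μ. Hence
--   * P is invariant iff it is quasi-symmetric and vanishes at every exponent μ with
--     c(μ) = 1: untwisted elements (w = 1) relocate exponents transitively within a
--     composition, and a diagonal element with w = ζ ≠ 1 forces such coefficients to 0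
--     (invariant⇒qsym, invariant⇒vanishes, qsym⇒invariant);
--   * quasi-symmetric polynomials vanishing off R[x₁ᵐ, …, xₙᵐ] are exactly the Q(x₁ᵐ, …, xₙᵐ)
--     with Q quasi-symmetric (qsym⇒substPow, substPow⇒qsym-vanishing).
module Submission where

open import Defs
open import Level using (Level)
open import Algebra.Bundles using (CommutativeRing)
open import Data.Nat using (ℕ; _≤_)
open import Data.Product using (_×_; Σ)
open import Function.Bundles using (_⇔_)

open import Algebra.Bundles using (AbelianGroup)
open import Data.Nat as ℕ using (zero; suc; NonZero; z≤n; s≤s)
open import Data.Nat.Properties using (0≢1+n)
open import Data.Nat.Divisibility using (_∣_; 1∣_)
open import Data.List.Relation.Unary.All using (universal)
open import Data.Bool using (Bool; true; false; if_then_else_)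
open import Data.Fin using (Fin; zero; suc)
open import Data.Fin.Permutation as Perm using (Permutation; _⟨$⟩ˡ_; flip)
open import Data.List as List using (List; []; _∷_)
open import Data.List.Relation.Unary.All using (All; []; _∷_)
open import Data.Vec as Vec using (Vec)
open import Data.Vec.Properties using (≡-dec)
open import Data.Product as Prod using (_,_; proj₁; proj₂)
open import Data.Sum using (_⊎_; inj₁; inj₂)
open import Data.Empty using (⊥-elim)
open import Function using (_∘_; id)
open import Function.Bundles using (mk⇔)
open import Relation.Nullary using (yes; no; ¬_)
open import Relation.Nullary.Decidable using (⌊_⌋)
open import Relation.Binary.PropositionalEquality as ≡ using (_≡_; _≢_; refl; cong)

module Exponents where
  open import Data.Nat using (_+_; _*_; _/_; _<_; s≤s⁻¹)
  open import Data.Nat.Properties using (*-comm; 1+n≢0; m≤n⇒m≤1+n; +-cancelˡ-≡; *-zeroʳ; *-cancelˡ-≡; m*n≢0; +-0-commutativeMonoid)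
  open import Data.Nat.DivMod using (m*n/n≡m; m*[n/m]≡n; 0/n≡0)
  open import Data.Nat.Divisibility using (_∣?_; m∣m*n)
  import Data.Nat.ListAction as ListAction
  open import Data.Fin using (punchIn)
  open import Data.Fin.Permutation using (_⟨$⟩ʳ_; inverseˡ; inverseʳ; insert; insert-punchIn)
  open import Data.List using (length)
  open import Data.List.Properties using (map-injective)
  open import Data.Vec using (lookup; tabulate)
  open import Data.Vec.Properties using (tabulate-cong; lookup∘tabulate)
  open import Data.Product using (∃)
  open import Relation.Binary.PropositionalEquality using (sym; trans; cong₂; subst; module ≡-Reasoning)
  open import Algebra.Properties.CommutativeMonoid.Sum +-0-commutativeMonoid using (sum; sum-remove; sum-permute; sum-cong-≗)

  indicator : Bool → ℕ
  indicator true = 1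
  indicator false = 0

  count : ∀ {n} → (Fin n → Bool) → ℕ
  count S = sum (indicator ∘ S)

  count-permute : ∀ {n} (S : Fin n → Bool) (σ : Permutation n n) → count (S ∘ (σ ⟨$⟩ˡ_)) ≡ count S
  count-permute S σ = sym (sum-permute (indicator ∘ S) (flip σ))

  count≤ : ∀ {n} (S : Fin n → Bool) → count S ≤ n
  count≤ {zero} S = z≤n
  count≤ {suc n} S with S zero
  ... | true = s≤s (count≤ (S ∘ suc))
  ... | false = m≤n⇒m≤1+n (count≤ (S ∘ suc))

  true-position : ∀ {n} (S : Fin n → Bool) → count S ≢ 0 → ∃ λ i → S i ≡ true
  true-position {zero} S count≢0 = ⊥-elim (count≢0 refl)
  true-position {suc n} S count≢0 with S zero in S₀
  ... | true = zero , S₀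
  ... | false = Prod.map suc id (true-position (S ∘ suc) count≢0)

  false-position : ∀ {n} (S : Fin n → Bool) → count S < n → ∃ λ i → S i ≡ false
  false-position {suc n} S count<n with S zero in S₀
  ... | false = zero , S₀
  ... | true = Prod.map suc id (false-position (S ∘ suc) (s≤s⁻¹ count<n))

  matching-position : ∀ {n} (S T : Fin (suc n) → Bool) → count S ≡ count T → ∃ λ i → S i ≡ T zero
  matching-position S T eq with T zero
  ... | true = true-position S (λ count≡0 → 1+n≢0 (trans (sym eq) count≡0))
  ... | false = false-position S (subst (_< suc _) (sym eq) (s≤s (count≤ (T ∘ suc))))

  insert-inverse-suc : ∀ {n} (i : Fin (suc n)) (π : Permutation n n) j →
                       insert i zero π ⟨$⟩ˡ suc j ≡ punchIn i (π ⟨$⟩ˡ j)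
  insert-inverse-suc i π j = begin
    σ ⟨$⟩ˡ suc j                            ≡⟨ cong ((σ ⟨$⟩ˡ_) ∘ suc) (inverseʳ π) ⟨
    σ ⟨$⟩ˡ suc (π ⟨$⟩ʳ (π ⟨$⟩ˡ j))          ≡⟨ cong (σ ⟨$⟩ˡ_) (insert-punchIn i zero π (π ⟨$⟩ˡ j)) ⟨
    σ ⟨$⟩ˡ (σ ⟨$⟩ʳ punchIn i (π ⟨$⟩ˡ j))    ≡⟨ inverseˡ σ ⟩
    punchIn i (π ⟨$⟩ˡ j)                    ∎
    where
    open ≡-Reasoning
    σ = insert i zero π

  align : ∀ {n} (S T : Fin n → Bool) → count S ≡ count T →
          Σ (Permutation n n) λ σ → ∀ j → S (σ ⟨$⟩ˡ j) ≡ T j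
  align {zero} S T _ = Perm.id , λ ()
  align {suc n} S T eq with matching-position S T eq
  ... | i , Si≡T₀ = insert i zero (proj₁ rest) , aligned
    where
    open ≡-Reasoning
    S′ : Fin n → Bool
    S′ = S ∘ punchIn i
    count-rest : count S′ ≡ count (T ∘ suc)
    count-rest = +-cancelˡ-≡ (indicator (T zero)) _ _ (begin
      indicator (T zero) + count S′ ≡⟨ cong (λ b → indicator b + count S′) Si≡T₀ ⟨
      indicator (S i) + count S′    ≡⟨ sum-remove (indicator ∘ S) ⟨
      count S                       ≡⟨ eq ⟩
      count T                       ∎)
    rest : Σ (Permutation n n) λ π → ∀ j → S′ (π ⟨$⟩ˡ j) ≡ T (suc j)
    rest = align S′ (T ∘ suc) count-rest
    aligned : ∀ j → S (insert i zero (proj₁ rest) ⟨$⟩ˡ j) ≡ T j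
    aligned zero = Si≡T₀
    aligned (suc j) = trans (cong S (insert-inverse-suc i (proj₁ rest) j)) (proj₂ rest j)

  support : ∀ {n} → Vec ℕ n → Fin n → Bool
  support ν j = nz (lookup ν j)

  fill-support : ∀ {n} (ν : Vec ℕ n) → fill (tabulate (support ν)) (compress ν) ≡ ν
  fill-support Vec.[] = refl
  fill-support (zero Vec.∷ ν) = cong (0 Vec.∷_) (fill-support ν)
  fill-support (suc k Vec.∷ ν) = cong (suc k Vec.∷_) (fill-support ν)

  length-compress : ∀ {n} (ν : Vec ℕ n) → length (compress ν) ≡ count (support ν)
  length-compress Vec.[] = refl
  length-compress (zero Vec.∷ ν) = length-compress ν
  length-compress (suc k Vec.∷ ν) = cong suc (length-compress ν)

  compress-positive : ∀ {n} (ν : Vec ℕ n) → All (λ k → nz k ≡ true) (compress ν)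
  compress-positive Vec.[] = []
  compress-positive (zero Vec.∷ ν) = compress-positive ν
  compress-positive (suc k Vec.∷ ν) = refl ∷ compress-positive ν

  fill-shape : ∀ {n} (S : Vec Bool n) (K : List ℕ) → All (λ k → nz k ≡ true) K → length K ≡ count (lookup S) →
               compress (fill S K) ≡ K × (∀ j → support (fill S K) j ≡ lookup S j)
  fill-shape Vec.[] [] _ _ = refl , λ ()
  fill-shape (false Vec.∷ S) K pos len with fill-shape S K pos len
  ... | same-parts , same-support = same-parts , λ { zero → refl ; (suc j) → same-support j }
  fill-shape (true Vec.∷ S) (suc k ∷ K) (_ ∷ pos) len with fill-shape S K pos (cong ℕ.pred len)
  ... | same-parts , same-support = cong (suc k ∷_) same-parts , λ { zero → refl ; (suc j) → same-support j }

  shape-determines : ∀ {n} {μ ν : Vec ℕ n} → compress μ ≡ compress ν → (∀ j → support μ j ≡ support ν j) → μ ≡ ν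
  shape-determines {μ = μ} {ν} same-parts same-support = begin
    μ                                          ≡⟨ fill-support μ ⟨
    fill (tabulate (support μ)) (compress μ)   ≡⟨ cong₂ fill (tabulate-cong same-support) same-parts ⟩
    fill (tabulate (support ν)) (compress ν)   ≡⟨ fill-support ν ⟩
    ν                                          ∎
    where open ≡-Reasoning

  relocate-shape : ∀ {n} (σ : Permutation n n) (ν : Vec ℕ n) →
    compress (relocate σ ν) ≡ compress ν × (∀ j → support (relocate σ ν) j ≡ support ν (σ ⟨$⟩ˡ j))
  relocate-shape σ ν = Prod.map id (λ same-support j → trans (same-support j) (lookup∘tabulate moved j))
    (fill-shape (tabulate moved) (compress ν) (compress-positive ν) (begin
      length (compress ν)                  ≡⟨ length-compress ν ⟩
      count (support ν)                    ≡⟨ count-permute (support ν) σ ⟨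
      count moved                          ≡⟨ sum-cong-≗ (cong indicator ∘ lookup∘tabulate moved) ⟨
      count (lookup (tabulate moved))      ∎))
    where
    open ≡-Reasoning
    moved : Fin _ → Bool
    moved j = support ν (σ ⟨$⟩ˡ j)

  relocate-cancel : ∀ {n} (σ τ : Permutation n n) (ν : Vec ℕ n) → (∀ j → σ ⟨$⟩ˡ (τ ⟨$⟩ˡ j) ≡ j) →
                    relocate τ (relocate σ ν) ≡ ν
  relocate-cancel σ τ ν στ≡id = shape-determines
    (trans (proj₁ (relocate-shape τ (relocate σ ν))) (proj₁ (relocate-shape σ ν)))
    (λ j → trans (proj₂ (relocate-shape τ (relocate σ ν)) j)
           (trans (proj₂ (relocate-shape σ ν) (τ ⟨$⟩ˡ j)) (cong (support ν) (στ≡id j))))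

  relocate-inverse : ∀ {n} (σ : Permutation n n) (ν μ : Vec ℕ n) → relocate σ ν ≡ μ → ν ≡ relocate (flip σ) μ
  relocate-inverse σ ν μ refl = sym (relocate-cancel σ (flip σ) ν (λ _ → inverseˡ σ))

  relocate-inverse⁻¹ : ∀ {n} (σ : Permutation n n) (ν μ : Vec ℕ n) → ν ≡ relocate (flip σ) μ → relocate σ ν ≡ μ
  relocate-inverse⁻¹ σ ν μ refl = relocate-cancel (flip σ) σ μ (λ _ → inverseʳ σ)

  relocate-id : ∀ {n} (μ : Vec ℕ n) → relocate Perm.id μ ≡ μ
  relocate-id = fill-support

  relocate-transitive : ∀ {n} (ν μ : Vec ℕ n) → compress ν ≡ compress μ → Σ (Permutation n n) λ σ → relocate σ ν ≡ μ
  relocate-transitive ν μ same-parts with align (support ν) (support μ) same-count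
    where
    same-count : count (support ν) ≡ count (support μ)
    same-count = trans (sym (length-compress ν)) (trans (cong length same-parts) (length-compress μ))
  ... | σ , aligned = σ , shape-determines
    (trans (proj₁ (relocate-shape σ ν)) same-parts)
    (λ j → trans (proj₂ (relocate-shape σ ν) j) (aligned j))

  cK-dichotomy : ∀ m K → (cK m K ≡ 0 × All (m ∣_) K) ⊎ cK m K ≡ 1
  cK-dichotomy m [] = inj₁ (refl , [])
  cK-dichotomy m (k ∷ K) with m ∣? k | cK-dichotomy m K
  ... | yes m∣k | inj₁ (c≡0 , all) = inj₁ (c≡0 , m∣k ∷ all)
  ... | yes _   | inj₂ c≡1 = inj₂ c≡1
  ... | no _    | _ = inj₂ refl

  cK-divisible : ∀ m K → All (m ∣_) K → cK m K ≡ 0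
  cK-divisible m [] [] = refl
  cK-divisible m (k ∷ K) (m∣k ∷ all) with m ∣? k
  ... | yes _ = cK-divisible m K all
  ... | no m∤k = ⊥-elim (m∤k m∣k)

  nz-positive : ∀ l .{{_ : NonZero l}} → nz l ≡ true
  nz-positive (suc _) = refl

  module Multiples (m : ℕ) .{{_ : NonZero m}} where

    scale : ∀ {n} → Vec ℕ n → Vec ℕ n
    scale = Vec.map (m *_)

    unscale : ∀ {n} → Vec ℕ n → Vec ℕ n
    unscale = Vec.map (_/ m)

    unscale-scale : ∀ {n} (κ : Vec ℕ n) → unscale (scale κ) ≡ κ
    unscale-scale Vec.[] = refl
    unscale-scale (k Vec.∷ κ) = cong₂ Vec._∷_ (trans (cong (_/ m) (*-comm m k)) (m*n/n≡m k m)) (unscale-scale κ)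

    scale-injective : ∀ {n} {κ κ′ : Vec ℕ n} → scale κ ≡ scale κ′ → κ ≡ κ′
    scale-injective {κ = κ} {κ′} eq = begin
      κ                   ≡⟨ unscale-scale κ ⟨
      unscale (scale κ)   ≡⟨ cong unscale eq ⟩
      unscale (scale κ′)  ≡⟨ unscale-scale κ′ ⟩
      κ′                  ∎
      where open ≡-Reasoning

    -- Scaling by m ≠ 0 keeps the support, so it acts on compositions part by part.
    compress-scale : ∀ {n} (κ : Vec ℕ n) → compress (scale κ) ≡ List.map (m *_) (compress κ)
    compress-scale Vec.[] = refl
    compress-scale (zero Vec.∷ κ) rewrite *-zeroʳ m = compress-scale κ
    compress-scale (suc k Vec.∷ κ) rewrite nz-positive (m * suc k) {{m*n≢0 m (suc k)}} =
      cong (m * suc k ∷_) (compress-scale κ)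

    compress-scale-cong : ∀ {n} (κ κ′ : Vec ℕ n) → compress κ ≡ compress κ′ → compress (scale κ) ≡ compress (scale κ′)
    compress-scale-cong κ κ′ eq = trans (compress-scale κ) (trans (cong (List.map (m *_)) eq) (sym (compress-scale κ′)))

    compress-scale-cancel : ∀ {n} (κ κ′ : Vec ℕ n) → compress (scale κ) ≡ compress (scale κ′) → compress κ ≡ compress κ′
    compress-scale-cancel κ κ′ eq = map-injective (λ {k} {k′} → *-cancelˡ-≡ k k′ m)
      (trans (sym (compress-scale κ)) (trans eq (compress-scale κ′)))

    cK-scale : ∀ {n} (κ : Vec ℕ n) → cK m (compress (scale κ)) ≡ 0
    cK-scale κ rewrite compress-scale κ = cK-divisible m _ (multiples (compress κ))
      where
      multiples : ∀ K → All (m ∣_) (List.map (m *_) K)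
      multiples [] = []
      multiples (k ∷ K) = m∣m*n k ∷ multiples K

    scale-unscale : ∀ {n} (μ : Vec ℕ n) → All (m ∣_) (compress μ) → scale (unscale μ) ≡ μ
    scale-unscale Vec.[] _ = refl
    scale-unscale (zero Vec.∷ μ) all = cong₂ Vec._∷_ (trans (cong (m *_) (0/n≡0 m)) (*-zeroʳ m)) (scale-unscale μ all)
    scale-unscale (suc k Vec.∷ μ) (m∣k ∷ all) = cong₂ Vec._∷_ (m*[n/m]≡n m∣k) (scale-unscale μ all)

  -- The twist exponents of an untwisted group element sum to 0, so such elements have w = 1.
  sum-zeros : ∀ n → ListAction.sum (Vec.toList (tabulate {n = n} (λ _ → 0))) ≡ 0
  sum-zeros zero = refl
  sum-zeros (suc n) = sum-zeros n

open Exponents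

module Polynomials {c ℓ : Level} (R : CommutativeRing c ℓ) where
  open CommutativeRing R hiding (zero) renaming (refl to ≈-refl; sym to ≈-sym; trans to ≈-trans)
  open Over R
  open import Algebra.Properties.Ring ring using (-1*x≈-x)
  open import Algebra.Properties.Group (AbelianGroup.group +-abelianGroup) using (x∙y⁻¹≈ε⇒x≈y; x≈y⇒x∙y⁻¹≈ε)
  open import Relation.Binary.Reasoning.Setoid setoid

  pow-one : ∀ k → pow 1# k ≈ 1#
  pow-one zero = ≈-refl
  pow-one (suc k) = ≈-trans (*-identityˡ _) (pow-one k)

  fixed-by-scalar : NoZeroDivisors → ∀ ζ x → ¬ ζ ≈ 1# → ζ * x ≈ x → x ≈ 0#
  fixed-by-scalar noZeroDivisors ζ x ζ≉1 ζx≈x with noZeroDivisors (ζ + - 1#) x (begin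
      (ζ + - 1#) * x    ≈⟨ distribʳ x ζ (- 1#) ⟩
      ζ * x + - 1# * x  ≈⟨ +-congˡ (-1*x≈-x x) ⟩
      ζ * x + - x       ≈⟨ x≈y⇒x∙y⁻¹≈ε ζx≈x ⟩
      0#                ∎)
  ... | inj₁ ζ-1≈0 = ⊥-elim (ζ≉1 (x∙y⁻¹≈ε⇒x≈y ζ 1# ζ-1≈0))
  ... | inj₂ x≈0 = x≈0

  coeff-map : ∀ {n} {F : Carrier × Vec ℕ n → Carrier × Vec ℕ n} (P : Poly n) (κ μ : Vec ℕ n) (s : Carrier) →
    (∀ a → proj₂ (F (a , κ)) ≡ μ × proj₁ (F (a , κ)) ≈ s * a) →
    (∀ a ν → ν ≢ κ → proj₂ (F (a , ν)) ≡ μ → proj₁ (F (a , ν)) ≈ 0#) →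
    coeff (List.map F P) μ ≈ s * coeff P κ
  coeff-map [] κ μ s hit stray = ≈-sym (zeroʳ s)
  coeff-map {F = F} ((a , ν) ∷ P) κ μ s hit stray with ≡-dec ℕ._≟_ ν κ
  ... | yes refl with ≡-dec ℕ._≟_ (proj₂ (F (a , κ))) μ
  ...   | yes _ = ≈-trans (+-cong (proj₂ (hit a)) (coeff-map P κ μ s hit stray)) (≈-sym (distribˡ s a _))
  ...   | no misses = ⊥-elim (misses (proj₁ (hit a)))
  coeff-map {F = F} ((a , ν) ∷ P) κ μ s hit stray | no ν≢κ = begin
      (if ⌊ ≡-dec ℕ._≟_ (proj₂ (F (a , ν))) μ ⌋ then proj₁ (F (a , ν)) else 0#) + coeff (List.map F P) μ
        ≈⟨ +-cong stray-zero (coeff-map P κ μ s hit stray) ⟩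
      0# + s * coeff P κ   ≈⟨ +-identityˡ _ ⟩
      s * coeff P κ        ≈⟨ *-congˡ (+-identityˡ _) ⟨
      s * (0# + coeff P κ) ∎
    where
    stray-zero : (if ⌊ ≡-dec ℕ._≟_ (proj₂ (F (a , ν))) μ ⌋ then proj₁ (F (a , ν)) else 0#) ≈ 0#
    stray-zero with ≡-dec ℕ._≟_ (proj₂ (F (a , ν))) μ
    ... | yes lands = stray a ν ν≢κ lands
    ... | no _ = ≈-refl

  coeff-map-miss : ∀ {n} {F : Carrier × Vec ℕ n → Carrier × Vec ℕ n} (P : Poly n) (μ : Vec ℕ n) →
    (∀ a ν → proj₂ (F (a , ν)) ≢ μ) → coeff (List.map F P) μ ≈ 0#
  coeff-map-miss [] μ misses = ≈-refl
  coeff-map-miss {F = F} ((a , ν) ∷ P) μ misses with ≡-dec ℕ._≟_ (proj₂ (F (a , ν))) μ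
  ... | yes lands = ⊥-elim (misses a ν lands)
  ... | no _ = ≈-trans (+-identityˡ _) (coeff-map-miss P μ misses)

  coeff-act : ∀ {n m} (ζ : Carrier) (g : Elt n m) (P : Poly n) (μ : Vec ℕ n) →
    coeff (act ζ g P) μ ≈ pow (w ζ g) (cK m (compress μ)) * coeff P (relocate (flip (Elt.σ g)) μ)
  coeff-act {m = m} ζ g P μ = coeff-map P (relocate (flip σ) μ) μ _
    (λ a → relocate-inverse⁻¹ σ _ μ refl ,
           *-congʳ (reflexive (cong (pow (w ζ g) ∘ cK m) (proj₁ (relocate-shape (flip σ) μ)))))
    (λ a ν ν≢ lands → ⊥-elim (ν≢ (relocate-inverse σ ν μ lands)))
    where
    σ : Permutation _ _
    σ = Elt.σ g

  Invariant : ∀ {n} → ℕ → Carrier → Poly n → Set ℓ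
  Invariant {n} m ζ P = ∀ (g : Elt n m) → act ζ g P ≈ₚ P

  VanishesOffMultiples : ∀ {n} → ℕ → Poly n → Set ℓ
  VanishesOffMultiples m P = ∀ μ → cK m (compress μ) ≡ 1 → coeff P μ ≈ 0#

  w-untwisted : ∀ {n m} (ζ : Carrier) (σ : Permutation n n) → w ζ (elt {n} {suc m} σ (λ _ → zero)) ≡ 1#
  w-untwisted {n} ζ σ = cong (pow ζ) (sum-zeros n)

  -- Invariance under the permutations alone forces quasi-symmetry:
  -- exponents with equal compositions are related by a relocation.
  invariant⇒qsym : ∀ {n m} (ζ : Carrier) (P : Poly n) → Invariant (suc m) ζ P → IsQSym P
  invariant⇒qsym {m = m} ζ P invariant ν μ same-parts with relocate-transitive ν μ same-parts
  ... | σ , refl = begin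
      coeff P ν                                   ≈⟨ *-identityˡ _ ⟨
      1# * coeff P ν                              ≈⟨ *-congʳ (pow-one e) ⟨
      pow 1# e * coeff P ν                        ≡⟨ ≡.cong₂ (λ x ν′ → pow x e * coeff P ν′) (≡.sym (w-untwisted {m = m} ζ σ)) (relocate-inverse σ ν _ refl) ⟩
      pow (w ζ g) e * coeff P (relocate (flip σ) (relocate σ ν)) ≈⟨ coeff-act ζ g P _ ⟨
      coeff (act ζ g P) (relocate σ ν)            ≈⟨ invariant g _ ⟩
      coeff P (relocate σ ν)                      ∎
    where
    g : Elt _ (suc m)
    g = elt σ (λ _ → zero)
    e : ℕ
    e = cK (suc m) (compress (relocate σ ν))

  -- Invariance under a diagonal element with w = ζ kills every monomial that is not in x₁ᵐ, …, xₙᵐ,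
  -- since ζ ≠ 1 for a primitive m-th root of unity when m ≥ 2 (for m = 1 there is nothing to show).
  invariant⇒vanishes : ∀ {n m} → NoZeroDivisors → (ζ : Carrier) → IsPrimitiveRoot (suc m) ζ →
    (P : Poly (suc n)) → Invariant (suc m) ζ P → VanishesOffMultiples (suc m) P
  invariant⇒vanishes {m = zero} _ ζ _ P _ μ c≡1 =
    ⊥-elim (0≢1+n (≡.trans (≡.sym (cK-divisible 1 _ (universal 1∣_ (compress μ)))) c≡1))
  invariant⇒vanishes {n} {suc m} noZeroDivisors ζ (_ , no-smaller-root) P invariant μ c≡1 =
    fixed-by-scalar noZeroDivisors ζ (coeff P μ) ζ≉1 (begin
      ζ * coeff P μ                                 ≈⟨ *-congʳ w≈ζ ⟨
      pow (w ζ g) 1 * coeff P μ                     ≡⟨ cong (λ k → pow (w ζ g) k * coeff P μ) c≡1 ⟨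
      pow (w ζ g) e * coeff P μ                     ≡⟨ cong (λ ν → pow (w ζ g) e * coeff P ν) (relocate-id μ) ⟨
      pow (w ζ g) e * coeff P (relocate (flip Perm.id) μ) ≈⟨ coeff-act ζ g P μ ⟨
      coeff (act ζ g P) μ                           ≈⟨ invariant g μ ⟩
      coeff P μ                                     ∎)
    where
    e : ℕ
    e = cK (suc (suc m)) (compress μ)
    twist : Fin (suc n) → Fin (suc (suc m))
    twist zero = suc zero
    twist (suc _) = zero
    g : Elt (suc n) (suc (suc m))
    g = elt Perm.id twist
    w≈ζ : w ζ g * 1# ≈ ζ
    w≈ζ = ≈-trans (*-identityʳ _) (≈-trans (reflexive (cong (λ k → ζ * pow ζ k) (sum-zeros n))) (*-identityʳ ζ))
    ζ≉1 : ¬ ζ ≈ 1#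
    ζ≉1 ζ≈1 = no-smaller-root 1 (s≤s z≤n) (s≤s (s≤s z≤n)) (≈-trans (*-identityʳ ζ) ζ≈1)

  -- Conversely, quasi-symmetry and vanishing off multiples of m give invariance:
  -- g • P has coefficient w(g)^0 · (coefficient at a relocated exponent) or 0.
  qsym⇒invariant : ∀ {n m} (ζ : Carrier) (P : Poly n) → IsQSym P → VanishesOffMultiples m P → Invariant m ζ P
  qsym⇒invariant {m = m} ζ P qsym vanish g μ with cK-dichotomy m (compress μ)
  ... | inj₁ (c≡0 , _) = begin
      coeff (act ζ g P) μ                              ≈⟨ coeff-act ζ g P μ ⟩
      pow (w ζ g) (cK m (compress μ)) * coeff P μ′     ≡⟨ cong (λ k → pow (w ζ g) k * coeff P μ′) c≡0 ⟩
      1# * coeff P μ′                                  ≈⟨ *-identityˡ _ ⟩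
      coeff P μ′                                       ≈⟨ qsym μ′ μ same-parts ⟩
      coeff P μ                                        ∎
    where
    μ′ : Vec ℕ _
    μ′ = relocate (flip (Elt.σ g)) μ
    same-parts : compress μ′ ≡ compress μ
    same-parts = proj₁ (relocate-shape (flip (Elt.σ g)) μ)
  ... | inj₂ c≡1 = begin
      coeff (act ζ g P) μ                              ≈⟨ coeff-act ζ g P μ ⟩
      pow (w ζ g) (cK m (compress μ)) * coeff P μ′     ≈⟨ *-congˡ (vanish μ′ (≡.trans (cong (cK m) same-parts) c≡1)) ⟩
      pow (w ζ g) (cK m (compress μ)) * 0#             ≈⟨ zeroʳ _ ⟩
      0#                                               ≈⟨ vanish μ c≡1 ⟨
      coeff P μ                                        ∎
    where
    μ′ : Vec ℕ _
    μ′ = relocate (flip (Elt.σ g)) μ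
    same-parts : compress μ′ ≡ compress μ
    same-parts = proj₁ (relocate-shape (flip (Elt.σ g)) μ)

  module Substitution (m : ℕ) .{{_ : NonZero m}} where
    open Multiples m

    coeff-substPow : ∀ {n} (Q : Poly n) (κ : Vec ℕ n) → coeff (substPow m Q) (scale κ) ≈ coeff Q κ
    coeff-substPow Q κ = ≈-trans
      (coeff-map Q κ (scale κ) 1# (λ a → refl , ≈-sym (*-identityˡ a))
                 (λ a ν ν≢κ lands → ⊥-elim (ν≢κ (scale-injective lands))))
      (*-identityˡ _)

    substPow-vanishes : ∀ {n} (Q : Poly n) → VanishesOffMultiples m (substPow m Q)
    substPow-vanishes Q μ c≡1 = coeff-map-miss Q μ
      (λ a ν lands → 0≢1+n (≡.trans (≡.sym (cK-scale ν)) (≡.trans (cong (cK m ∘ compress) lands) c≡1)))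

    -- Q(x₁ᵐ, …, xₙᵐ) is quasi-symmetric when Q is: equal compositions of multiples of m
    -- come from equal compositions of the divided exponents.
    substPow-qsym : ∀ {n} (Q : Poly n) → IsQSym Q → IsQSym (substPow m Q)
    substPow-qsym Q qsym ν μ same-parts with cK-dichotomy m (compress ν)
    ... | inj₂ c≡1 = ≈-trans (substPow-vanishes Q ν c≡1)
                             (≈-sym (substPow-vanishes Q μ (≡.trans (cong (cK m) (≡.sym same-parts)) c≡1)))
    ... | inj₁ (_ , ν-divisible) = begin
        coeff (substPow m Q) ν                   ≡⟨ cong (coeff (substPow m Q)) ν≡ ⟨
        coeff (substPow m Q) (scale (unscale ν)) ≈⟨ coeff-substPow Q (unscale ν) ⟩
        coeff Q (unscale ν)                      ≈⟨ qsym (unscale ν) (unscale μ) (compress-scale-cancel (unscale ν) (unscale μ) scaled-parts) ⟩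
        coeff Q (unscale μ)                      ≈⟨ coeff-substPow Q (unscale μ) ⟨
        coeff (substPow m Q) (scale (unscale μ)) ≡⟨ cong (coeff (substPow m Q)) μ≡ ⟩
        coeff (substPow m Q) μ                   ∎
      where
      ν≡ : scale (unscale ν) ≡ ν
      ν≡ = scale-unscale ν ν-divisible
      μ≡ : scale (unscale μ) ≡ μ
      μ≡ = scale-unscale μ (≡.subst (All (m ∣_)) same-parts ν-divisible)
      scaled-parts : compress (scale (unscale ν)) ≡ compress (scale (unscale μ))
      scaled-parts = ≡.trans (cong compress ν≡) (≡.trans same-parts (cong compress (≡.sym μ≡)))

    substPow⇒qsym-vanishing : ∀ {n} (P Q : Poly n) → IsQSym Q → P ≈ₚ substPow m Q →
                              IsQSym P × VanishesOffMultiples m P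
    substPow⇒qsym-vanishing P Q Q-qsym P≈ =
      (λ ν μ same-parts → ≈-trans (P≈ ν) (≈-trans (substPow-qsym Q Q-qsym ν μ same-parts) (≈-sym (P≈ μ)))) ,
      (λ μ c≡1 → ≈-trans (P≈ μ) (substPow-vanishes Q μ c≡1))

    descend : ∀ {n} → Poly n → Poly n
    descend = List.map λ (a , ν) → (if ⌊ ≡-dec ℕ._≟_ (scale (unscale ν)) ν ⌋ then a else 0#) , unscale ν

    coeff-descend : ∀ {n} (P : Poly n) (κ : Vec ℕ n) → coeff (descend P) κ ≈ coeff P (scale κ)
    coeff-descend P κ = ≈-trans (coeff-map P (scale κ) κ 1# hit stray) (*-identityˡ _)
      where
      hit : ∀ a → unscale (scale κ) ≡ κ ×
            (if ⌊ ≡-dec ℕ._≟_ (scale (unscale (scale κ))) (scale κ) ⌋ then a else 0#) ≈ 1# * a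
      hit a with ≡-dec ℕ._≟_ (scale (unscale (scale κ))) (scale κ)
      ... | yes _ = unscale-scale κ , ≈-sym (*-identityˡ a)
      ... | no not-multiple = ⊥-elim (not-multiple (cong scale (unscale-scale κ)))
      stray : ∀ a ν → ν ≢ scale κ → unscale ν ≡ κ →
              (if ⌊ ≡-dec ℕ._≟_ (scale (unscale ν)) ν ⌋ then a else 0#) ≈ 0#
      stray a ν ν≢ lands with ≡-dec ℕ._≟_ (scale (unscale ν)) ν
      ... | yes multiple = ⊥-elim (ν≢ (≡.trans (≡.sym multiple) (cong scale lands)))
      ... | no _ = ≈-refl

    qsym⇒substPow : ∀ {n} (P : Poly n) → IsQSym P → VanishesOffMultiples m P →
                    IsQSym (descend P) × P ≈ₚ substPow m (descend P)
    qsym⇒substPow P qsym vanish = descend-qsym , P≈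
      where
      descend-qsym : IsQSym (descend P)
      descend-qsym κ κ′ same-parts = begin
        coeff (descend P) κ   ≈⟨ coeff-descend P κ ⟩
        coeff P (scale κ)     ≈⟨ qsym (scale κ) (scale κ′) (compress-scale-cong κ κ′ same-parts) ⟩
        coeff P (scale κ′)    ≈⟨ coeff-descend P κ′ ⟨
        coeff (descend P) κ′  ∎
      P≈ : P ≈ₚ substPow m (descend P)
      P≈ μ with cK-dichotomy m (compress μ)
      ... | inj₂ c≡1 = ≈-trans (vanish μ c≡1) (≈-sym (substPow-vanishes (descend P) μ c≡1))
      ... | inj₁ (_ , μ-divisible) = begin
        coeff P μ                                       ≡⟨ cong (coeff P) μ≡ ⟨
        coeff P (scale (unscale μ))                     ≈⟨ coeff-descend P (unscale μ) ⟨
        coeff (descend P) (unscale μ)                   ≈⟨ coeff-substPow (descend P) (unscale μ) ⟨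
        coeff (substPow m (descend P)) (scale (unscale μ)) ≡⟨ cong (coeff (substPow m (descend P))) μ≡ ⟩
        coeff (substPow m (descend P)) μ                ∎
        where
        μ≡ : scale (unscale μ) ≡ μ
        μ≡ = scale-unscale μ μ-divisible

proposition2p1 : ∀ {c ℓ : Level} (n m : ℕ) → 1 ≤ n → 1 ≤ m →
    (R : CommutativeRing c ℓ) → let open Over R in
    NoZeroDivisors → (ζ : CommutativeRing.Carrier R) → IsPrimitiveRoot m ζ →
    (P : Poly n) →
    ((∀ (g : Elt n m) → act ζ g P ≈ₚ P) ⇔ Σ (Poly n) (λ Q → IsQSym Q × (P ≈ₚ substPow m Q)))
proposition2p1 (suc n) (suc m) (s≤s z≤n) (s≤s z≤n) R noZeroDivisors ζ primitive-root P = mk⇔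
  (λ invariant → descend P , qsym⇒substPow P (invariant⇒qsym ζ P invariant)
                                             (invariant⇒vanishes noZeroDivisors ζ primitive-root P invariant))
  (λ (Q , Q-qsym , P≈) → let P-qsym , P-vanishes = substPow⇒qsym-vanishing P Q Q-qsym P≈
                          in qsym⇒invariant ζ P P-qsym P-vanishes)
  where
  open Polynomials R
  open Substitution (suc m)
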